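{- Let $\varphi$ be a quantifier-free $\mathcal{T}$-formula which is $\mathcal{T}$-reduced with respect to a finite set of atoms $\boldsymbol{\alpha}$ containing its atoms, and let $l$ be a literal on $\boldsymbol{\alpha}$. Then $\varphi|_{l}\wedge l$ is $\mathcal{T}$-reduced with respect to $\boldsymbol{\alpha}$.
   Context: $\mathcal{T}$-formulas are quantifier-free formulas built by Boolean connectives from $\mathcal{T}$-atoms and Boolean atoms. $\varphi|_{l}$ (residual of $\varphi$ under $l$) is the formula obtained by substituting in $\varphi$ the atom of $l$ by the truth constant making $l$ true and propagating constants in the standard way. $\psi\models_p\chi$ means the Boolean abstraction (atoms mapped bijectively to Boolean variables) of $\psi$ propositionally entails that of $\chi$. A total truth assignment on $\boldsymbol{\alpha}$ is a conjunction containing, for each $a\in\boldsymbol{\alpha}$, exactly one of $a,\neg a$. $P_{\boldsymbol{\alpha}}(\psi)$ is the set of $\mathcal{T}$-unsatisfiable total truth assignments $\rho$ on $\boldsymbol{\alpha}$ with $\rho\models_p\psi$; $\psi$ is $\mathcal{T}$-reduced with respect to $\boldsymbol{\alpha}$ iff $P_{\boldsymbol{\alpha}}(\psi)=\emptyset$. -}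

module Defs where

open import Data.Bool using (Bool; true; false; not; _∧_; _∨_; if_then_else_)
open import Data.List using (List; []; _∷_; _++_)
open import Data.List.Membership.Propositional using (_∈_)
open import Data.List.Relation.Unary.All using (All)
open import Data.Product using (Σ; ∃; _×_; _,_)
open import Relation.Binary.PropositionalEquality using (_≡_)
open import Relation.Binary.Definitions using (DecidableEquality)
open import Relation.Nullary using (¬_; yes; no)

-- Quantifier-free formulas over a type of atoms (T-atoms and Boolean atoms).
data Formula (Atom : Set) : Set where
  tt ff : Formula Atom
  atom  : Atom → Formula Atom
  ¬'_   : Formula Atom → Formula Atom
  _∧'_ _∨'_ _⇒'_ _⇔'_ : Formula Atom → Formula Atom → Formula Atom

module _ {Atom : Set} where

  atoms : Formula Atom → List Atom
  atoms tt = []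
  atoms ff = []
  atoms (atom a) = a ∷ []
  atoms (¬' φ) = atoms φ
  atoms (φ ∧' ψ) = atoms φ ++ atoms ψ
  atoms (φ ∨' ψ) = atoms φ ++ atoms ψ
  atoms (φ ⇒' ψ) = atoms φ ++ atoms ψ
  atoms (φ ⇔' ψ) = atoms φ ++ atoms ψ

  -- propositional evaluation under a valuation of the atoms
  -- (atoms are their own Boolean abstraction)
  eval : (Atom → Bool) → Formula Atom → Bool
  eval v tt = true
  eval v ff = false
  eval v (atom a) = v a
  eval v (¬' φ) = not (eval v φ)
  eval v (φ ∧' ψ) = eval v φ ∧ eval v ψ
  eval v (φ ∨' ψ) = eval v φ ∨ eval v ψ
  eval v (φ ⇒' ψ) = not (eval v φ) ∨ eval v ψ
  eval v (φ ⇔' ψ) = if eval v φ then eval v ψ else not (eval v ψ)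

  _⊨p_ : Formula Atom → Formula Atom → Set
  ψ ⊨p χ = ∀ (v : Atom → Bool) → eval v ψ ≡ true → eval v χ ≡ true

  -- Literals: an atom with a polarity (true = positive)
  Literal : Set
  Literal = Atom × Bool

  litF : Literal → Formula Atom
  litF (a , true) = atom a
  litF (a , false) = ¬' atom a

  neg : Formula Atom → Formula Atom
  neg tt = ff
  neg ff = tt
  neg φ = ¬' φ

  conj : Formula Atom → Formula Atom → Formula Atom
  conj tt ψ = ψ
  conj ff ψ = ff
  conj φ tt = φ
  conj φ ff = ff
  conj φ ψ = φ ∧' ψ

  disj : Formula Atom → Formula Atom → Formula Atom
  disj tt ψ = tt
  disj ff ψ = ψ
  disj φ tt = tt
  disj φ ff = φ
  disj φ ψ = φ ∨' ψ

  impl : Formula Atom → Formula Atom → Formula Atom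
  impl tt ψ = ψ
  impl ff ψ = tt
  impl φ tt = tt
  impl φ ff = neg φ
  impl φ ψ = φ ⇒' ψ

  iff : Formula Atom → Formula Atom → Formula Atom
  iff tt ψ = ψ
  iff ff ψ = neg ψ
  iff φ tt = φ
  iff φ ff = neg φ
  iff φ ψ = φ ⇔' ψ

  residual : DecidableEquality Atom → Formula Atom → Literal → Formula Atom
  residual _≟_ tt l = tt
  residual _≟_ ff l = ff
  residual _≟_ (atom b) (a , s) with b ≟ a
  ... | yes _ = if s then tt else ff
  ... | no _ = atom b
  residual _≟_ (¬' φ) l = neg (residual _≟_ φ l)
  residual _≟_ (φ ∧' ψ) l = conj (residual _≟_ φ l) (residual _≟_ ψ l)
  residual _≟_ (φ ∨' ψ) l = disj (residual _≟_ φ l) (residual _≟_ ψ l)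
  residual _≟_ (φ ⇒' ψ) l = impl (residual _≟_ φ l) (residual _≟_ ψ l)
  residual _≟_ (φ ⇔' ψ) l = iff (residual _≟_ φ l) (residual _≟_ ψ l)

  assignment : List Atom → (Atom → Bool) → Formula Atom
  assignment [] σ = tt
  assignment (a ∷ α) σ = litF (a , σ a) ∧' assignment α σ

  TotalAssignment : List Atom → Formula Atom → Set
  TotalAssignment α ρ = ∃ λ (σ : Atom → Bool) → ρ ≡ assignment α σ

-- A theory T, given semantically: its models, each inducing a truth value
-- for every atom.  A formula is T-satisfiable iff some model makes it true.
record Theory (Atom : Set) : Set₁ where
  field
    Model : Set
    val   : Model → Atom → Bool

module _ {Atom : Set} (T : Theory Atom) where
  open Theory T

  TSat : Formula Atom → Set
  TSat φ = ∃ λ (M : Model) → eval (val M) φ ≡ true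

  TUnsat : Formula Atom → Set
  TUnsat φ = ¬ TSat φ

  InP : List Atom → Formula Atom → Formula Atom → Set
  InP α ψ ρ = TotalAssignment α ρ × TUnsat ρ × (ρ ⊨p ψ)

  TReduced : List Atom → Formula Atom → Set
  TReduced α ψ = ∀ ρ → ¬ InP α ψ ρ

-- Under any valuation that makes the literal l true, substituting the constant
-- for the atom of l does not change the truth value of φ, so φ|l ∧ l ⊨p φ.  Hence
-- every assignment in P_α(φ|l ∧ l) already lies in P_α(φ), which is empty.
module Submission where

open import Defs
open import Data.Bool using (Bool; true; false; not; _∧_; _∨_; if_then_else_)
open import Data.Bool.Properties using (∧-identityʳ; ∧-zeroʳ; ∨-identityʳ; ∨-zeroʳ; ∧-conicalˡ; ∧-conicalʳ)
open import Data.List using (List)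
open import Data.List.Membership.Propositional using (_∈_)
open import Data.List.Relation.Unary.All using (All)
open import Data.Product using (_,_)
open import Relation.Binary.Definitions using (DecidableEquality)
open import Relation.Binary.PropositionalEquality using (_≡_; refl; sym; trans; cong; cong₂)
open import Relation.Nullary using (yes; no)

if-then-true-else-false : ∀ b → (if b then true else false) ≡ b
if-then-true-else-false true  = refl
if-then-true-else-false false = refl

if-then-false-else-true : ∀ b → (if b then false else true) ≡ not b
if-then-false-else-true true  = refl
if-then-false-else-true false = refl

module _ {Atom : Set} (v : Atom → Bool) where

  eval-neg : ∀ (φ : Formula Atom) → eval v (neg φ) ≡ not (eval v φ)
  eval-neg tt       = refl
  eval-neg ff       = refl
  eval-neg (atom _) = refl
  eval-neg (¬' _)   = refl
  eval-neg (_ ∧' _) = refl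
  eval-neg (_ ∨' _) = refl
  eval-neg (_ ⇒' _) = refl
  eval-neg (_ ⇔' _) = refl

  eval-conj : ∀ (φ ψ : Formula Atom) → eval v (conj φ ψ) ≡ eval v φ ∧ eval v ψ
  eval-conj tt       _ = refl
  eval-conj ff       _ = refl
  eval-conj (atom _) tt       = sym (∧-identityʳ _)
  eval-conj (atom _) ff       = sym (∧-zeroʳ _)
  eval-conj (atom _) (atom _) = refl
  eval-conj (atom _) (¬' _)   = refl
  eval-conj (atom _) (_ ∧' _) = refl
  eval-conj (atom _) (_ ∨' _) = refl
  eval-conj (atom _) (_ ⇒' _) = refl
  eval-conj (atom _) (_ ⇔' _) = refl
  eval-conj (¬' _)   tt       = sym (∧-identityʳ _)
  eval-conj (¬' _)   ff       = sym (∧-zeroʳ _)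
  eval-conj (¬' _)   (atom _) = refl
  eval-conj (¬' _)   (¬' _)   = refl
  eval-conj (¬' _)   (_ ∧' _) = refl
  eval-conj (¬' _)   (_ ∨' _) = refl
  eval-conj (¬' _)   (_ ⇒' _) = refl
  eval-conj (¬' _)   (_ ⇔' _) = refl
  eval-conj (_ ∧' _) tt       = sym (∧-identityʳ _)
  eval-conj (_ ∧' _) ff       = sym (∧-zeroʳ _)
  eval-conj (_ ∧' _) (atom _) = refl
  eval-conj (_ ∧' _) (¬' _)   = refl
  eval-conj (_ ∧' _) (_ ∧' _) = refl
  eval-conj (_ ∧' _) (_ ∨' _) = refl
  eval-conj (_ ∧' _) (_ ⇒' _) = refl
  eval-conj (_ ∧' _) (_ ⇔' _) = refl
  eval-conj (_ ∨' _) tt       = sym (∧-identityʳ _)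
  eval-conj (_ ∨' _) ff       = sym (∧-zeroʳ _)
  eval-conj (_ ∨' _) (atom _) = refl
  eval-conj (_ ∨' _) (¬' _)   = refl
  eval-conj (_ ∨' _) (_ ∧' _) = refl
  eval-conj (_ ∨' _) (_ ∨' _) = refl
  eval-conj (_ ∨' _) (_ ⇒' _) = refl
  eval-conj (_ ∨' _) (_ ⇔' _) = refl
  eval-conj (_ ⇒' _) tt       = sym (∧-identityʳ _)
  eval-conj (_ ⇒' _) ff       = sym (∧-zeroʳ _)
  eval-conj (_ ⇒' _) (atom _) = refl
  eval-conj (_ ⇒' _) (¬' _)   = refl
  eval-conj (_ ⇒' _) (_ ∧' _) = refl
  eval-conj (_ ⇒' _) (_ ∨' _) = refl
  eval-conj (_ ⇒' _) (_ ⇒' _) = refl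
  eval-conj (_ ⇒' _) (_ ⇔' _) = refl
  eval-conj (_ ⇔' _) tt       = sym (∧-identityʳ _)
  eval-conj (_ ⇔' _) ff       = sym (∧-zeroʳ _)
  eval-conj (_ ⇔' _) (atom _) = refl
  eval-conj (_ ⇔' _) (¬' _)   = refl
  eval-conj (_ ⇔' _) (_ ∧' _) = refl
  eval-conj (_ ⇔' _) (_ ∨' _) = refl
  eval-conj (_ ⇔' _) (_ ⇒' _) = refl
  eval-conj (_ ⇔' _) (_ ⇔' _) = refl

  eval-disj : ∀ (φ ψ : Formula Atom) → eval v (disj φ ψ) ≡ eval v φ ∨ eval v ψ
  eval-disj tt       _ = refl
  eval-disj ff       _ = refl
  eval-disj (atom _) tt       = sym (∨-zeroʳ _)
  eval-disj (atom _) ff       = sym (∨-identityʳ _)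
  eval-disj (atom _) (atom _) = refl
  eval-disj (atom _) (¬' _)   = refl
  eval-disj (atom _) (_ ∧' _) = refl
  eval-disj (atom _) (_ ∨' _) = refl
  eval-disj (atom _) (_ ⇒' _) = refl
  eval-disj (atom _) (_ ⇔' _) = refl
  eval-disj (¬' _)   tt       = sym (∨-zeroʳ _)
  eval-disj (¬' _)   ff       = sym (∨-identityʳ _)
  eval-disj (¬' _)   (atom _) = refl
  eval-disj (¬' _)   (¬' _)   = refl
  eval-disj (¬' _)   (_ ∧' _) = refl
  eval-disj (¬' _)   (_ ∨' _) = refl
  eval-disj (¬' _)   (_ ⇒' _) = refl
  eval-disj (¬' _)   (_ ⇔' _) = refl
  eval-disj (_ ∧' _) tt       = sym (∨-zeroʳ _)
  eval-disj (_ ∧' _) ff       = sym (∨-identityʳ _)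
  eval-disj (_ ∧' _) (atom _) = refl
  eval-disj (_ ∧' _) (¬' _)   = refl
  eval-disj (_ ∧' _) (_ ∧' _) = refl
  eval-disj (_ ∧' _) (_ ∨' _) = refl
  eval-disj (_ ∧' _) (_ ⇒' _) = refl
  eval-disj (_ ∧' _) (_ ⇔' _) = refl
  eval-disj (_ ∨' _) tt       = sym (∨-zeroʳ _)
  eval-disj (_ ∨' _) ff       = sym (∨-identityʳ _)
  eval-disj (_ ∨' _) (atom _) = refl
  eval-disj (_ ∨' _) (¬' _)   = refl
  eval-disj (_ ∨' _) (_ ∧' _) = refl
  eval-disj (_ ∨' _) (_ ∨' _) = refl
  eval-disj (_ ∨' _) (_ ⇒' _) = refl
  eval-disj (_ ∨' _) (_ ⇔' _) = refl
  eval-disj (_ ⇒' _) tt       = sym (∨-zeroʳ _)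
  eval-disj (_ ⇒' _) ff       = sym (∨-identityʳ _)
  eval-disj (_ ⇒' _) (atom _) = refl
  eval-disj (_ ⇒' _) (¬' _)   = refl
  eval-disj (_ ⇒' _) (_ ∧' _) = refl
  eval-disj (_ ⇒' _) (_ ∨' _) = refl
  eval-disj (_ ⇒' _) (_ ⇒' _) = refl
  eval-disj (_ ⇒' _) (_ ⇔' _) = refl
  eval-disj (_ ⇔' _) tt       = sym (∨-zeroʳ _)
  eval-disj (_ ⇔' _) ff       = sym (∨-identityʳ _)
  eval-disj (_ ⇔' _) (atom _) = refl
  eval-disj (_ ⇔' _) (¬' _)   = refl
  eval-disj (_ ⇔' _) (_ ∧' _) = refl
  eval-disj (_ ⇔' _) (_ ∨' _) = refl
  eval-disj (_ ⇔' _) (_ ⇒' _) = refl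
  eval-disj (_ ⇔' _) (_ ⇔' _) = refl

  eval-impl : ∀ (φ ψ : Formula Atom) → eval v (impl φ ψ) ≡ not (eval v φ) ∨ eval v ψ
  eval-impl tt       _ = refl
  eval-impl ff       _ = refl
  eval-impl (atom _) tt       = sym (∨-zeroʳ _)
  eval-impl (atom _) ff       = sym (∨-identityʳ _)
  eval-impl (atom _) (atom _) = refl
  eval-impl (atom _) (¬' _)   = refl
  eval-impl (atom _) (_ ∧' _) = refl
  eval-impl (atom _) (_ ∨' _) = refl
  eval-impl (atom _) (_ ⇒' _) = refl
  eval-impl (atom _) (_ ⇔' _) = refl
  eval-impl (¬' _)   tt       = sym (∨-zeroʳ _)
  eval-impl (¬' _)   ff       = sym (∨-identityʳ _)
  eval-impl (¬' _)   (atom _) = refl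
  eval-impl (¬' _)   (¬' _)   = refl
  eval-impl (¬' _)   (_ ∧' _) = refl
  eval-impl (¬' _)   (_ ∨' _) = refl
  eval-impl (¬' _)   (_ ⇒' _) = refl
  eval-impl (¬' _)   (_ ⇔' _) = refl
  eval-impl (_ ∧' _) tt       = sym (∨-zeroʳ _)
  eval-impl (_ ∧' _) ff       = sym (∨-identityʳ _)
  eval-impl (_ ∧' _) (atom _) = refl
  eval-impl (_ ∧' _) (¬' _)   = refl
  eval-impl (_ ∧' _) (_ ∧' _) = refl
  eval-impl (_ ∧' _) (_ ∨' _) = refl
  eval-impl (_ ∧' _) (_ ⇒' _) = refl
  eval-impl (_ ∧' _) (_ ⇔' _) = refl
  eval-impl (_ ∨' _) tt       = sym (∨-zeroʳ _)
  eval-impl (_ ∨' _) ff       = sym (∨-identityʳ _)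
  eval-impl (_ ∨' _) (atom _) = refl
  eval-impl (_ ∨' _) (¬' _)   = refl
  eval-impl (_ ∨' _) (_ ∧' _) = refl
  eval-impl (_ ∨' _) (_ ∨' _) = refl
  eval-impl (_ ∨' _) (_ ⇒' _) = refl
  eval-impl (_ ∨' _) (_ ⇔' _) = refl
  eval-impl (_ ⇒' _) tt       = sym (∨-zeroʳ _)
  eval-impl (_ ⇒' _) ff       = sym (∨-identityʳ _)
  eval-impl (_ ⇒' _) (atom _) = refl
  eval-impl (_ ⇒' _) (¬' _)   = refl
  eval-impl (_ ⇒' _) (_ ∧' _) = refl
  eval-impl (_ ⇒' _) (_ ∨' _) = refl
  eval-impl (_ ⇒' _) (_ ⇒' _) = refl
  eval-impl (_ ⇒' _) (_ ⇔' _) = refl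
  eval-impl (_ ⇔' _) tt       = sym (∨-zeroʳ _)
  eval-impl (_ ⇔' _) ff       = sym (∨-identityʳ _)
  eval-impl (_ ⇔' _) (atom _) = refl
  eval-impl (_ ⇔' _) (¬' _)   = refl
  eval-impl (_ ⇔' _) (_ ∧' _) = refl
  eval-impl (_ ⇔' _) (_ ∨' _) = refl
  eval-impl (_ ⇔' _) (_ ⇒' _) = refl
  eval-impl (_ ⇔' _) (_ ⇔' _) = refl

  eval-iff : ∀ (φ ψ : Formula Atom) → eval v (iff φ ψ) ≡ (if eval v φ then eval v ψ else not (eval v ψ))
  eval-iff tt       _ = refl
  eval-iff ff       ψ = eval-neg ψ
  eval-iff (atom _) tt       = sym (if-then-true-else-false _)
  eval-iff (atom _) ff       = sym (if-then-false-else-true _)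
  eval-iff (atom _) (atom _) = refl
  eval-iff (atom _) (¬' _)   = refl
  eval-iff (atom _) (_ ∧' _) = refl
  eval-iff (atom _) (_ ∨' _) = refl
  eval-iff (atom _) (_ ⇒' _) = refl
  eval-iff (atom _) (_ ⇔' _) = refl
  eval-iff (¬' _)   tt       = sym (if-then-true-else-false _)
  eval-iff (¬' _)   ff       = sym (if-then-false-else-true _)
  eval-iff (¬' _)   (atom _) = refl
  eval-iff (¬' _)   (¬' _)   = refl
  eval-iff (¬' _)   (_ ∧' _) = refl
  eval-iff (¬' _)   (_ ∨' _) = refl
  eval-iff (¬' _)   (_ ⇒' _) = refl
  eval-iff (¬' _)   (_ ⇔' _) = refl
  eval-iff (_ ∧' _) tt       = sym (if-then-true-else-false _)
  eval-iff (_ ∧' _) ff       = sym (if-then-false-else-true _)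
  eval-iff (_ ∧' _) (atom _) = refl
  eval-iff (_ ∧' _) (¬' _)   = refl
  eval-iff (_ ∧' _) (_ ∧' _) = refl
  eval-iff (_ ∧' _) (_ ∨' _) = refl
  eval-iff (_ ∧' _) (_ ⇒' _) = refl
  eval-iff (_ ∧' _) (_ ⇔' _) = refl
  eval-iff (_ ∨' _) tt       = sym (if-then-true-else-false _)
  eval-iff (_ ∨' _) ff       = sym (if-then-false-else-true _)
  eval-iff (_ ∨' _) (atom _) = refl
  eval-iff (_ ∨' _) (¬' _)   = refl
  eval-iff (_ ∨' _) (_ ∧' _) = refl
  eval-iff (_ ∨' _) (_ ∨' _) = refl
  eval-iff (_ ∨' _) (_ ⇒' _) = refl
  eval-iff (_ ∨' _) (_ ⇔' _) = refl
  eval-iff (_ ⇒' _) tt       = sym (if-then-true-else-false _)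
  eval-iff (_ ⇒' _) ff       = sym (if-then-false-else-true _)
  eval-iff (_ ⇒' _) (atom _) = refl
  eval-iff (_ ⇒' _) (¬' _)   = refl
  eval-iff (_ ⇒' _) (_ ∧' _) = refl
  eval-iff (_ ⇒' _) (_ ∨' _) = refl
  eval-iff (_ ⇒' _) (_ ⇒' _) = refl
  eval-iff (_ ⇒' _) (_ ⇔' _) = refl
  eval-iff (_ ⇔' _) tt       = sym (if-then-true-else-false _)
  eval-iff (_ ⇔' _) ff       = sym (if-then-false-else-true _)
  eval-iff (_ ⇔' _) (atom _) = refl
  eval-iff (_ ⇔' _) (¬' _)   = refl
  eval-iff (_ ⇔' _) (_ ∧' _) = refl
  eval-iff (_ ⇔' _) (_ ∨' _) = refl
  eval-iff (_ ⇔' _) (_ ⇒' _) = refl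
  eval-iff (_ ⇔' _) (_ ⇔' _) = refl

  eval-residual : (_≟_ : DecidableEquality Atom) (a : Atom) (s : Bool) → v a ≡ s →
                  ∀ φ → eval v (residual _≟_ φ (a , s)) ≡ eval v φ
  eval-residual _≟_ a s va≡s = go
    where
    eval-if-tt-ff : ∀ b → eval v (if b then tt else ff) ≡ b
    eval-if-tt-ff true  = refl
    eval-if-tt-ff false = refl

    _|l : Formula Atom → Formula Atom
    φ |l = residual _≟_ φ (a , s)

    go : ∀ φ → eval v (φ |l) ≡ eval v φ
    go tt = refl
    go ff = refl
    go (atom b) with b ≟ a
    ... | yes refl = trans (eval-if-tt-ff s) (sym va≡s)
    ... | no _     = refl
    go (¬' φ)   = trans (eval-neg (φ |l)) (cong not (go φ))
    go (φ ∧' ψ) = trans (eval-conj (φ |l) (ψ |l)) (cong₂ _∧_ (go φ) (go ψ))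
    go (φ ∨' ψ) = trans (eval-disj (φ |l) (ψ |l)) (cong₂ _∨_ (go φ) (go ψ))
    go (φ ⇒' ψ) = trans (eval-impl (φ |l) (ψ |l)) (cong₂ (λ x y → not x ∨ y) (go φ) (go ψ))
    go (φ ⇔' ψ) = trans (eval-iff (φ |l) (ψ |l)) (cong₂ (λ x y → if x then y else not y) (go φ) (go ψ))

  eval-litF≡true⇒ : ∀ a s → eval v (litF (a , s)) ≡ true → v a ≡ s
  eval-litF≡true⇒ a true  va≡true = va≡true
  eval-litF≡true⇒ a false _ with v a
  ... | false = refl

residual∧litF⊨p : {Atom : Set} (_≟_ : DecidableEquality Atom) (φ : Formula Atom) (a : Atom) (s : Bool) →
                  (residual _≟_ φ (a , s) ∧' litF (a , s)) ⊨p φ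
residual∧litF⊨p _≟_ φ a s v holds =
  trans (sym (eval-residual v _≟_ a s (eval-litF≡true⇒ v a s (∧-conicalʳ ⟦φ|l⟧ ⟦l⟧ holds)) φ))
        (∧-conicalˡ ⟦φ|l⟧ ⟦l⟧ holds)
  where
  ⟦φ|l⟧ ⟦l⟧ : Bool
  ⟦φ|l⟧ = eval v (residual _≟_ φ (a , s))
  ⟦l⟧   = eval v (litF (a , s))

TReduced-antitone : {Atom : Set} (T : Theory Atom) (α : List Atom) (ψ χ : Formula Atom) →
                    ψ ⊨p χ → TReduced T α χ → TReduced T α ψ
TReduced-antitone T α ψ χ ψ⊨χ reduced ρ (total , unsat , ρ⊨ψ) =
  reduced ρ (total , unsat , λ w ρ-holds → ψ⊨χ w (ρ⊨ψ w ρ-holds))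

lemmaA3 : {Atom : Set} (_≟_ : DecidableEquality Atom) (T : Theory Atom)
    (α : List Atom) (φ : Formula Atom) → All (_∈ α) (atoms φ)
    → TReduced T α φ
    → (a : Atom) (s : Bool) → a ∈ α
    → TReduced T α (residual _≟_ φ (a , s) ∧' litF (a , s))
lemmaA3 _≟_ T α φ _ reduced a s _ =
  TReduced-antitone T α (residual _≟_ φ (a , s) ∧' litF (a , s)) φ (residual∧litF⊨p _≟_ φ a s) reduced
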